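{- Let $G$ be a finite graph and $e=(u,v)\in E(G)$. Let $H$ be the graph obtained from the disjoint union $G\cup G$ of two copies of $G$ by deleting the two copies $(u_1,v_1)$ and $(u_2,v_2)$ of the edge $e$ and adding the edges $(u_1,v_2)$ and $(u_2,v_1)$ (where $u_i,v_i$ are the copies of $u,v$ in the $i$-th copy of $G$). Then $$F(G)^2\leq F(H).$$
   Context: $F(G)$ is the number of forests of $G$, i.e. edge subsets $A\subseteq E(G)$ containing no cycle. -}

module Defs where

open import Data.Nat using (ℕ; zero; suc; _+_)
open import Data.Bool using (Bool; true; false)
open import Data.Fin using (Fin; splitAt; _↑ˡ_; _↑ʳ_)
open import Data.Fin.Properties using () renaming (_≟_ to _≟ᶠ_)
open import Data.Fin.Subset using (Subset; _∈_)
open import Data.Fin.Subset.Properties using (_∈?_)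
open import Data.Product using (_×_; _,_; proj₁; proj₂; ∃₂)
open import Data.Product.Properties using (≡-dec)
open import Data.Sum using (_⊎_; inj₁; inj₂)
open import Relation.Nullary.Decidable using () renaming (_⊎-dec_ to _⊎?_)
open import Data.List using (List; []; _∷_; _++_; [_]; map; concatMap; cartesianProduct; zip; length; filter; allFin; applyUpTo; concat)
open import Data.List.Relation.Unary.All using (All; all?)
open import Data.List.Relation.Unary.Any using (Any; any?)
import Data.List.Relation.Unary.Unique.DecPropositional as UniqueDec
open import Relation.Binary.PropositionalEquality using (_≡_)
open import Relation.Nullary using (Dec; yes; no; ¬_; ¬?; _×-dec_)

-- Finite (multi)graphs: n vertices Fin n, m edges Fin m; edge i joins
-- the two (not necessarily distinct) vertices ends i.
record Graph : Set where
  field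
    n    : ℕ
    m    : ℕ
    ends : Fin m → Fin n × Fin n
open Graph public

Joins : (G : Graph) → Fin (m G) → Fin (n G) → Fin (n G) → Set
Joins G i x y = (ends G i ≡ (x , y)) ⊎ (ends G i ≡ (y , x))

joins? : (G : Graph) → ∀ i x y → Dec (Joins G i x y)
joins? G i x y = ≡-dec _≟ᶠ_ _≟ᶠ_ (ends G i) (x , y) ⊎? ≡-dec _≟ᶠ_ _≟ᶠ_ (ends G i) (y , x)

rotate : ∀ {A : Set} → List A → List A
rotate []       = []
rotate (x ∷ xs) = xs ++ [ x ]

-- A cycle in the edge set A: edges e₁ … e_k (k ≥ 1) and vertices
-- v₁ … v_k, edges pairwise distinct, vertices pairwise distinct, all eᵢ ∈ A,
-- and eᵢ joins vᵢ and v_{i+1} (indices mod k, so e_k joins v_k and v₁).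
-- (k = 1: a loop; k = 2: two parallel edges.)
IsCycle : (G : Graph) → Subset (m G) → List (Fin (m G)) → List (Fin (n G)) → Set
IsCycle G A es vs =
  (length es ≡ length vs) ×
  ((¬ (es ≡ [])) ×
  (UniqueDec.Unique _≟ᶠ_ es ×
  (UniqueDec.Unique _≟ᶠ_ vs ×
  (All (λ i → i ∈ A) es ×
   All (λ p → Joins G (proj₁ p) (proj₁ (proj₂ p)) (proj₂ (proj₂ p)))
       (zip es (zip vs (rotate vs)))))))

isCycle? : (G : Graph) (A : Subset (m G)) → ∀ es vs → Dec (IsCycle G A es vs)
isCycle? G A es vs =
  Data.Nat._≟_ (length es) (length vs) ×-dec
  (¬? (Data.List.Properties.≡-dec _≟ᶠ_ es []) ×-dec
  (UniqueDec.unique? _≟ᶠ_ es ×-dec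
  (UniqueDec.unique? _≟ᶠ_ vs ×-dec
  (all? (λ i → i ∈? A) es ×-dec
   all? (λ p → joins? G (proj₁ p) (proj₁ (proj₂ p)) (proj₂ (proj₂ p)))
        (zip es (zip vs (rotate vs)))))))
  where import Data.Nat; import Data.List.Properties

listsOf : ∀ {A : Set} → ℕ → List A → List (List A)
listsOf zero    xs = [] ∷ []
listsOf (suc k) xs = concatMap (λ x → map (x ∷_) (listsOf k xs)) xs

-- Since the edges of a cycle are pairwise distinct, a cycle has at most m
-- edges; so every cycle occurs among these candidates (length 0 … m).
candidates : (G : Graph) → List (List (Fin (m G)) × List (Fin (n G)))
candidates G = concat (applyUpTo (λ k →
  cartesianProduct (listsOf k (allFin (m G))) (listsOf k (allFin (n G))))
  (suc (m G)))

HasCycle : (G : Graph) → Subset (m G) → Set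
HasCycle G A = Any (λ c → IsCycle G A (proj₁ c) (proj₂ c)) (candidates G)

IsForest : (G : Graph) → Subset (m G) → Set
IsForest G A = ¬ HasCycle G A

isForest? : (G : Graph) (A : Subset (m G)) → Dec (IsForest G A)
isForest? G A = ¬? (any? (λ c → isCycle? G A (proj₁ c) (proj₂ c)) (candidates G))

allSubsets : (k : ℕ) → List (Subset k)
allSubsets zero    = Data.Vec.[] ∷ []
  where import Data.Vec
allSubsets (suc k) = concatMap (λ b → map (b Data.Vec.∷_) (allSubsets k)) (true ∷ false ∷ [])
  where import Data.Vec

F : Graph → ℕ
F G = length (filter (isForest? G) (allSubsets (m G)))

-- Vertices: x ↑ˡ n is the copy x₁ of x, n ↑ʳ x the copy x₂.
-- Edges: i ↑ˡ m is the copy of i in copy 1, m ↑ʳ i in copy 2;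
-- the two copies of e are replaced by (u₁ , v₂) and (u₂ , v₁).
H : (G : Graph) → Fin (m G) → Graph
H G e = record { n = n G + n G ; m = m G + m G ; ends = ends′ }
  where
  c₁ c₂ : Fin (n G) → Fin (n G + n G)
  c₁ x = x ↑ˡ n G
  c₂ x = n G ↑ʳ x
  u = proj₁ (ends G e)
  v = proj₂ (ends G e)
  ends′ : Fin (m G + m G) → Fin (n G + n G) × Fin (n G + n G)
  ends′ j with splitAt (m G) j
  ... | inj₁ i with i ≟ᶠ e
  ...   | yes _ = c₁ u , c₂ v
  ...   | no  _ = c₁ (proj₁ (ends G i)) , c₁ (proj₂ (ends G i))
  ends′ j | inj₂ i with i ≟ᶠ e
  ...   | yes _ = c₂ u , c₁ v
  ...   | no  _ = c₂ (proj₁ (ends G i)) , c₂ (proj₂ (ends G i))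

module Submission where

-- Since F(H) counts edge subsets of H = two copies of the edge set of G, it
-- suffices to show that for forests A₁, A₂ of G the edge set A₁ ⊎ A₂ of H
-- (A₁ in the first copy, A₂ in the second) is again a forest: then
-- (A₁ , A₂) ↦ A₁ ++ A₂ injects pairs of forests of G into forests of H.
-- Suppose C is a cycle of H inside A₁ ⊎ A₂.  If C avoids both cross edges
-- u₁v₂ and u₂v₁, it stays inside one copy and is a copy of a cycle of G
-- inside A₁ or A₂.  Otherwise, rotate C to start with a cross edge; as a
-- cross edge switches copies, C has to cross back, using the other cross
-- edge.  So e ∈ A₁ and e ∈ A₂, and the path of C between the two cross
-- edges lies in one copy, where it runs between u and v; closed by e it is
-- a cycle of G inside A₁ or A₂.

open import Defs
open import Data.Fin using (Fin)
open import Data.Nat using (_*_; _≤_)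

open import Data.Bool using (true; false)
open import Data.Empty using (⊥-elim)
open import Data.Fin as Fin using (splitAt; _↑ˡ_; _↑ʳ_)
open import Data.Fin.Properties using (↑ˡ-injective; ↑ʳ-injective; splitAt-↑ˡ; splitAt-↑ʳ; join-splitAt; injective⇒≤)
  renaming (_≟_ to _≟ᶠ_)
open import Data.Fin.Subset using (Subset; _∈_)
open import Data.List using (List; []; _∷_; _++_; [_]; map; length; filter; zip; lookup; allFin; cartesianProduct)
open import Data.List.Properties using (filter-++; length-++; ++-identityʳ; map-++; ++-assoc; ++-conicalˡ; ++-conicalʳ)
open import Data.List.Membership.Propositional using () renaming (_∈_ to _∈ₗ_)
open import Data.List.Membership.Propositional.Properties
  using (∈-lookup; ∈-concat⁺′; ∈-map⁺; ∈-allFin; ∈-cartesianProduct⁺; ∈-applyUpTo⁺)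
open import Data.List.Relation.Unary.All as All using (All; []; _∷_)
import Data.List.Relation.Unary.All.Properties as All
open import Data.List.Relation.Unary.AllPairs as AllPairs using ([]; _∷_)
import Data.List.Relation.Unary.AllPairs.Properties as AllPairs
import Data.List.Relation.Unary.Any as Any
open import Data.List.Relation.Unary.First using () renaming (first to first-or-all; _++_∷_ to split-at-first)
open import Data.List.Relation.Unary.First.Properties using (toView)
open import Data.List.Relation.Unary.Unique.Propositional using (Unique)
open import Data.List.Relation.Unary.Unique.Propositional.Properties using (map⁻)
import Data.List.Relation.Binary.Permutation.Setoid.Properties as Permutation
open import Data.List.Relation.Binary.Sublist.Propositional using (⊆-reflexive)
open import Data.List.Relation.Binary.Sublist.Propositional.Properties using (filter⁺; length-mono-≤)
open import Data.Nat using (ℕ; zero; suc; pred; _+_; z≤n; s≤s)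
open import Data.Nat.Properties using (+-identityʳ; *-distribʳ-+; +-mono-≤; module ≤-Reasoning)
open import Data.Product using (_×_; _,_; proj₁; proj₂; ∃; ∃₂)
open import Data.Product.Properties using (,-injective)
open import Data.Sum using (_⊎_; inj₁; inj₂)
import Data.Vec as V
open import Data.Vec.Properties using (lookup-++ˡ; lookup-++ʳ; []=⇒lookup; lookup⇒[]=)
open import Function using (_∘_)
open import Relation.Binary.PropositionalEquality
  using (_≡_; _≢_; refl; sym; trans; cong; cong₂; subst; subst₂; setoid; module ≡-Reasoning)
open import Relation.Nullary using (yes; no; ¬_)
open import Relation.Unary using (Decidable)

-- (1) Counting subsets

count : ∀ {k} {P : Subset k → Set} → Decidable P → ℕ
count {k} P? = length (filter P? (allSubsets k))

length-filter-map : ∀ {A B : Set} {P : B → Set} (P? : Decidable P) (f : A → B) (xs : List A) →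
  length (filter P? (map f xs)) ≡ length (filter (P? ∘ f) xs)
length-filter-map P? f [] = refl
length-filter-map P? f (x ∷ xs) with P? (f x)
... | yes _ = cong suc (length-filter-map P? f xs)
... | no _  = length-filter-map P? f xs

count-suc : ∀ {k} {P : Subset (suc k) → Set} (P? : Decidable P) →
  count P? ≡ count (P? ∘ (true V.∷_)) + count (P? ∘ (false V.∷_))
count-suc {k} P? = begin
  length (filter P? (with-0 ++ (without-0 ++ [])))
    ≡⟨ cong (λ xs → length (filter P? (with-0 ++ xs))) (++-identityʳ without-0) ⟩
  length (filter P? (with-0 ++ without-0))
    ≡⟨ cong length (filter-++ P? with-0 without-0) ⟩
  length (filter P? with-0 ++ filter P? without-0)
    ≡⟨ length-++ (filter P? with-0) ⟩
  length (filter P? with-0) + length (filter P? without-0)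
    ≡⟨ cong₂ _+_ (length-filter-map P? _ (allSubsets k)) (length-filter-map P? _ (allSubsets k)) ⟩
  count (P? ∘ (true V.∷_)) + count (P? ∘ (false V.∷_)) ∎
  where
  open ≡-Reasoning
  with-0 without-0 : List (Subset (suc k))
  with-0    = map (true V.∷_) (allSubsets k)
  without-0 = map (false V.∷_) (allSubsets k)

count-mono : ∀ {k} {P Q : Subset k → Set} (P? : Decidable P) (Q? : Decidable Q) →
  (∀ {x} → P x → Q x) → count P? ≤ count Q?
count-mono {k} P? Q? P⇒Q = length-mono-≤ (filter⁺ P? Q? (λ { refl → P⇒Q }) (⊆-reflexive (refl {x = allSubsets k})))

-- If Q₁ x and Q₂ y imply P (x ++ y), then, as concatenation is injective,
-- there are at least as many subsets satisfying P as pairs satisfying Q₁, Q₂.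
count-product : ∀ k {l} {Q₁ : Subset k → Set} {Q₂ : Subset l → Set} {P : Subset (k + l) → Set}
  (Q₁? : Decidable Q₁) (Q₂? : Decidable Q₂) (P? : Decidable P) →
  (∀ x y → Q₁ x → Q₂ y → P (x V.++ y)) → count Q₁? * count Q₂? ≤ count P?
count-product zero Q₁? Q₂? P? glue with Q₁? V.[]
... | yes q₁ = begin
  count Q₂? + 0 ≡⟨ +-identityʳ _ ⟩
  count Q₂?     ≤⟨ count-mono Q₂? P? (glue V.[] _ q₁) ⟩
  count P?      ∎
  where open ≤-Reasoning
... | no _ = z≤n
count-product (suc k) Q₁? Q₂? P? glue = begin
  count Q₁? * count Q₂?
    ≡⟨ cong (_* count Q₂?) (count-suc Q₁?) ⟩
  (count (Q₁? ∘ (true V.∷_)) + count (Q₁? ∘ (false V.∷_))) * count Q₂?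
    ≡⟨ *-distribʳ-+ (count Q₂?) (count (Q₁? ∘ (true V.∷_))) _ ⟩
  count (Q₁? ∘ (true V.∷_)) * count Q₂? + count (Q₁? ∘ (false V.∷_)) * count Q₂?
    ≤⟨ +-mono-≤ (count-product k _ Q₂? _ (λ x → glue (true V.∷ x)))
                (count-product k _ Q₂? _ (λ x → glue (false V.∷ x))) ⟩
  count (P? ∘ (true V.∷_)) + count (P? ∘ (false V.∷_))
    ≡⟨ sym (count-suc P?) ⟩
  count P? ∎
  where open ≤-Reasoning

unique-++ˡ : ∀ {A : Set} {xs ys : List A} → Unique (xs ++ ys) → Unique xs
unique-++ˡ {xs = []}     _         = []
unique-++ˡ {xs = x ∷ xs} (x∉ ∷ u) = All.++⁻ˡ xs x∉ ∷ unique-++ˡ u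

unique-upto : ∀ {A : Set} xs {y : A} {ys} → Unique (xs ++ y ∷ ys) → Unique (xs ++ [ y ])
unique-upto xs {y} {ys} u = unique-++ˡ (subst Unique (sym (++-assoc xs [ y ] ys)) u)

unique-snoc : ∀ {A : Set} {xs : List A} {y} → Unique xs → All (_≢ y) xs → Unique (xs ++ [ y ])
unique-snoc u fresh = AllPairs.++⁺ u ([] ∷ []) (All.map (_∷ []) fresh)

unique-swap : ∀ {A : Set} (xs ys : List A) → Unique (xs ++ ys) → Unique (ys ++ xs)
unique-swap {A} xs ys = Permutation.Unique-resp-↭ (setoid A) (Permutation.++-comm (setoid A) xs ys)

lookup-injective : ∀ {A : Set} {xs : List A} → Unique xs → ∀ i j → lookup xs i ≡ lookup xs j → i ≡ j
lookup-injective (_ ∷ _)  Fin.zero    Fin.zero    _  = refl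
lookup-injective (x∉ ∷ _) Fin.zero    (Fin.suc j) eq = ⊥-elim (All.lookup x∉ (∈-lookup j) eq)
lookup-injective (x∉ ∷ _) (Fin.suc i) Fin.zero    eq = ⊥-elim (All.lookup x∉ (∈-lookup i) (sym eq))
lookup-injective (_ ∷ u)  (Fin.suc i) (Fin.suc j) eq = cong Fin.suc (lookup-injective u i j eq)

unique-length : ∀ {k} {xs : List (Fin k)} → Unique xs → length xs ≤ k
unique-length u = injective⇒≤ (lookup-injective u _ _)

-- (2) Walks and cycles in an arbitrary graph

-- A walk in G from x to y along edges of A; es lists the edges in order and
-- vs the vertex from which each of them is traversed.
data Walk (G : Graph) (A : Subset (m G)) :
    Fin (n G) → List (Fin (m G)) → List (Fin (n G)) → Fin (n G) → Set where
  []   : ∀ {x} → Walk G A x [] [] x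
  step : ∀ {x z y i es vs} → Joins G i x z → i ∈ A → Walk G A z es vs y → Walk G A x (i ∷ es) (x ∷ vs) y

walk-++ : ∀ {G A x y z es₁ es₂ vs₁ vs₂} →
  Walk G A x es₁ vs₁ y → Walk G A y es₂ vs₂ z → Walk G A x (es₁ ++ es₂) (vs₁ ++ vs₂) z
walk-++ []             w₂ = w₂
walk-++ (step j i∈A w₁) w₂ = step j i∈A (walk-++ w₁ w₂)

walk-split : ∀ {G A x z} es₁ {es₂ vs} → Walk G A x (es₁ ++ es₂) vs z →
  ∃ λ y → ∃₂ λ vs₁ vs₂ → vs ≡ vs₁ ++ vs₂ × Walk G A x es₁ vs₁ y × Walk G A y es₂ vs₂ z
walk-split []        w = _ , [] , _ , refl , [] , w
walk-split (i ∷ es₁) (step j i∈A w) with walk-split es₁ w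
... | y , vs₁ , vs₂ , refl , w₁ , w₂ = y , _ ∷ vs₁ , vs₂ , refl , step j i∈A w₁ , w₂

swap-joins : ∀ G {i x y} → Joins G i x y → Joins G i y x
swap-joins G (inj₁ eq) = inj₂ eq
swap-joins G (inj₂ eq) = inj₁ eq

JoinsTriple : (G : Graph) → Fin (m G) × Fin (n G) × Fin (n G) → Set
JoinsTriple G t = Joins G (proj₁ t) (proj₁ (proj₂ t)) (proj₂ (proj₂ t))

walk⇒zip : ∀ {G A es x ws y} → Walk G A x es (x ∷ ws) y →
  length es ≡ suc (length ws) × All (_∈ A) es × All (JoinsTriple G) (zip es (zip (x ∷ ws) (ws ++ [ y ])))
walk⇒zip (step j i∈A [])            = refl , i∈A ∷ [] , j ∷ []
walk⇒zip (step j i∈A w@(step _ _ _)) with walk⇒zip w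
... | len , ∈A , joins = cong suc len , i∈A ∷ ∈A , j ∷ joins

zip⇒walk : ∀ {G A} es x ws y → length es ≡ suc (length ws) → All (_∈ A) es →
  All (JoinsTriple G) (zip es (zip (x ∷ ws) (ws ++ [ y ]))) → Walk G A x es (x ∷ ws) y
zip⇒walk (i ∷ [])     x []       y _   (i∈A ∷ []) (j ∷ []) = step j i∈A []
zip⇒walk (i ∷ es)     x (w ∷ ws) y len (i∈A ∷ ∈A) (j ∷ joins) =
  step j i∈A (zip⇒walk es w ws y (cong pred len) ∈A joins)
zip⇒walk (_ ∷ _ ∷ _)  x []       y ()  _ _

∈-listsOf : ∀ {k} (xs : List (Fin k)) → xs ∈ₗ listsOf (length xs) (allFin k)
∈-listsOf []       = Any.here refl
∈-listsOf (x ∷ xs) = ∈-concat⁺′ (∈-map⁺ (x ∷_) (∈-listsOf xs)) (∈-map⁺ _ (∈-allFin x))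

∈-candidates : ∀ G {es : List (Fin (m G))} {vs} → length es ≡ length vs → Unique es → (es , vs) ∈ₗ candidates G
∈-candidates G {es} {vs} len ue = ∈-concat⁺′
  (∈-cartesianProduct⁺ (∈-listsOf es) (subst (λ k → vs ∈ₗ listsOf k (allFin (n G))) (sym len) (∈-listsOf vs)))
  (∈-applyUpTo⁺ (λ k → cartesianProduct (listsOf k (allFin (m G))) (listsOf k (allFin (n G))))
                (s≤s (unique-length ue)))

CycleWalk : (G : Graph) → Subset (m G) → Fin (n G) → List (Fin (m G)) → List (Fin (n G)) → Set
CycleWalk G A x es vs = Walk G A x es vs x × ¬ es ≡ [] × Unique es × Unique vs

cycleWalk⇒hasCycle : ∀ {G A x es vs} → CycleWalk G A x es vs → HasCycle G A
cycleWalk⇒hasCycle ([] , ne , _) = ⊥-elim (ne refl)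
cycleWalk⇒hasCycle {G} {A} (w@(step _ _ _) , ne , ue , uv) with walk⇒zip w
... | len , ∈A , joins = Any.map (λ eq → subst (λ c → IsCycle G A (proj₁ c) (proj₂ c)) eq (len , ne , ue , uv , ∈A , joins))
                                 (∈-candidates G len ue)

hasCycle⇒cycleWalk : ∀ {G A} → HasCycle G A → ∃ λ x → ∃₂ λ es vs → CycleWalk G A x es vs
hasCycle⇒cycleWalk hc with Any.satisfied hc
... | ([]    , []) , (_ , ne , _) = ⊥-elim (ne refl)
... | (_ ∷ _ , []) , (() , _)
... | (es , x ∷ ws) , (len , ne , ue , uv , ∈A , joins) = x , es , x ∷ ws , zip⇒walk es x ws x len ∈A joins , ne , ue , uv

rotate-cycleWalk : ∀ {G A x vs} es₁ {es₂} → CycleWalk G A x (es₁ ++ es₂) vs → ∃₂ λ y vs′ → CycleWalk G A y (es₂ ++ es₁) vs′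
rotate-cycleWalk es₁ {es₂} (w , ne , ue , uv) with walk-split es₁ w
... | y , vs₁ , vs₂ , refl , w₁ , w₂ =
  y , vs₂ ++ vs₁ , walk-++ w₂ w₁ , ne′ , unique-swap es₁ es₂ ue , unique-swap vs₁ vs₂ uv
  where
  ne′ : ¬ es₂ ++ es₁ ≡ []
  ne′ eq = ne (cong₂ _++_ (++-conicalʳ es₂ es₁ eq) (++-conicalˡ es₂ es₁ eq))

close-path : ∀ {G A w es vs p i} → Walk G A w es vs p → Joins G i p w → i ∈ A →
  All (_≢ i) es → Unique es → Unique (vs ++ [ p ]) → HasCycle G A
close-path {es = es} {i = i} w j i∈A fresh ue uv =
  cycleWalk⇒hasCycle (walk-++ w (step j i∈A []) , nonempty , unique-snoc ue fresh , uv)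
  where
  nonempty : ¬ es ++ [ i ] ≡ []
  nonempty eq with ++-conicalʳ es [ i ] eq
  ... | ()

-- (3) The two copies

data Side : Set where
  first second : Side

other : Side → Side
other first  = second
other second = first

other-≢ : ∀ s → other s ≢ s
other-≢ first  ()
other-≢ second ()

two-sides : ∀ {t t′ : Side} → t ≢ t′ → ∀ s → s ≡ t ⊎ s ≡ t′
two-sides {first}  {first}  t≢t′ _      = ⊥-elim (t≢t′ refl)
two-sides {second} {second} t≢t′ _      = ⊥-elim (t≢t′ refl)
two-sides {first}  {second} _    first  = inj₁ refl
two-sides {first}  {second} _    second = inj₂ refl
two-sides {second} {first}  _    first  = inj₂ refl
two-sides {second} {first}  _    second = inj₁ refl

copy : ∀ {k} → Side → Fin k → Fin (k + k)
copy {k} first  i = i ↑ˡ k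
copy {k} second i = k ↑ʳ i

copy-injective : ∀ {k} s t {i j : Fin k} → copy s i ≡ copy t j → s ≡ t × i ≡ j
copy-injective {k} first  first  eq = refl , ↑ˡ-injective k _ _ eq
copy-injective {k} second second eq = refl , ↑ʳ-injective k _ _ eq
copy-injective {k} first  second {i} {j} eq
  with trans (sym (splitAt-↑ˡ k i k)) (trans (cong (splitAt k) eq) (splitAt-↑ʳ k k j))
... | ()
copy-injective {k} second first {i} {j} eq
  with trans (sym (splitAt-↑ʳ k k i)) (trans (cong (splitAt k) eq) (splitAt-↑ˡ k j k))
... | ()

data CopyView {k} : Fin (k + k) → Set where
  copy-of : ∀ s (i : Fin k) → CopyView (copy s i)

copy-view : ∀ {k} j → CopyView {k} j
copy-view {k} j with splitAt k j | join-splitAt k k j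
... | inj₁ i | refl = copy-of first i
... | inj₂ i | refl = copy-of second i

-- H G e as a double cover of G: every vertex and edge of H is a copy of one
-- of G, and only the copies of e (the cross edges) switch copies.
module DoubleCover (G : Graph) (e : Fin (m G)) where

  u v : Fin (n G)
  u = proj₁ (ends G e)
  v = proj₂ (ends G e)

  ends-ordinary : ∀ s {i} → i ≢ e → ends (H G e) (copy s i) ≡ (copy s (proj₁ (ends G i)) , copy s (proj₂ (ends G i)))
  ends-ordinary first {i} i≢e rewrite splitAt-↑ˡ (m G) i (m G) with i ≟ᶠ e
  ... | yes i≡e = ⊥-elim (i≢e i≡e)
  ... | no _    = refl
  ends-ordinary second {i} i≢e rewrite splitAt-↑ʳ (m G) (m G) i with i ≟ᶠ e
  ... | yes i≡e = ⊥-elim (i≢e i≡e)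
  ... | no _    = refl

  ends-cross : ∀ s → ends (H G e) (copy s e) ≡ (copy s u , copy (other s) v)
  ends-cross first rewrite splitAt-↑ˡ (m G) e (m G) with e ≟ᶠ e
  ... | yes _   = refl
  ... | no e≢e  = ⊥-elim (e≢e refl)
  ends-cross second rewrite splitAt-↑ʳ (m G) (m G) e with e ≟ᶠ e
  ... | yes _   = refl
  ... | no e≢e  = ⊥-elim (e≢e refl)

  joins-ordinary : ∀ {t s} {i : Fin (m G)} {x : Fin (n G)} {z} → i ≢ e → Joins (H G e) (copy t i) (copy s x) z →
    t ≡ s × ∃ λ y → z ≡ copy s y × Joins G i x y
  joins-ordinary {t} {s} {i} i≢e (inj₁ eq) with ,-injective (trans (sym (ends-ordinary t i≢e)) eq)
  ... | start , refl with copy-injective t s start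
  ...   | refl , refl = refl , proj₂ (ends G i) , refl , inj₁ refl
  joins-ordinary {t} {s} {i} i≢e (inj₂ eq) with ,-injective (trans (sym (ends-ordinary t i≢e)) eq)
  ... | refl , end with copy-injective t s end
  ...   | refl , refl = refl , proj₁ (ends G i) , refl , inj₂ refl

  cross-switches : ∀ t s {x y : Fin (n G)} → ¬ Joins (H G e) (copy t e) (copy s x) (copy s y)
  cross-switches t s (inj₁ eq) = same-copy (trans (sym (ends-cross t)) eq)
    where
    same-copy : ∀ {x y : Fin (n G)} → (copy t u , copy (other t) v) ≢ (copy s x , copy s y)
    same-copy eq with ,-injective eq
    ... | eq₁ , eq₂ = other-≢ t (trans (proj₁ (copy-injective (other t) s eq₂)) (sym (proj₁ (copy-injective t s eq₁))))
  cross-switches t s {x} {y} (inj₂ eq) = cross-switches t s {y} {x} (inj₁ eq)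

  endOn : Side → Side → Fin (n G)
  endOn first  first  = u
  endOn second second = u
  endOn first  second = v
  endOn second first  = v

  cross-end : ∀ t s {x : Fin (n G)} {z} → Joins (H G e) (copy t e) (copy s x) z → x ≡ endOn t s
  cross-end t s (inj₁ eq) with copy-injective t s (proj₁ (,-injective (trans (sym (ends-cross t)) eq)))
  ... | refl , refl = u-on-own-side t
    where
    u-on-own-side : ∀ t → u ≡ endOn t t
    u-on-own-side first  = refl
    u-on-own-side second = refl
  cross-end t s (inj₂ eq) with copy-injective (other t) s (proj₂ (,-injective (trans (sym (ends-cross t)) eq)))
  ... | refl , refl = v-on-other-side t
    where
    v-on-other-side : ∀ t → v ≡ endOn t (other t)
    v-on-other-side first  = refl
    v-on-other-side second = refl

  endOn-joins : ∀ {t t′} → t ≢ t′ → ∀ s → Joins G e (endOn t′ s) (endOn t s)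
  endOn-joins {first}  {first}  t≢t′ _      = ⊥-elim (t≢t′ refl)
  endOn-joins {second} {second} t≢t′ _      = ⊥-elim (t≢t′ refl)
  endOn-joins {first}  {second} _    first  = inj₂ refl
  endOn-joins {first}  {second} _    second = inj₁ refl
  endOn-joins {second} {first}  _    first  = inj₁ refl
  endOn-joins {second} {first}  _    second = inj₂ refl

  Ordinary Cross : Fin (m G + m G) → Set
  Ordinary j = ∃₂ λ t i → i ≢ e × j ≡ copy t i
  Cross j    = ∃ λ t → j ≡ copy t e

  classify : ∀ j → Ordinary j ⊎ Cross j
  classify j with copy-view {m G} j
  ... | copy-of t i with i ≟ᶠ e
  ...   | yes refl = inj₂ (t , refl)
  ...   | no i≢e   = inj₁ (t , i , i≢e , refl)

  module _ (A : Side → Subset (m G)) where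

    B : Subset (m G + m G)
    B = A first V.++ A second

    copy-∈ : ∀ {s i} → copy s i ∈ B → i ∈ A s
    copy-∈ {first}  {i} i∈ = lookup⇒[]= i (A first)  (trans (sym (lookup-++ˡ (A first) (A second) i)) ([]=⇒lookup i∈))
    copy-∈ {second} {i} i∈ = lookup⇒[]= i (A second) (trans (sym (lookup-++ʳ (A first) (A second) i)) ([]=⇒lookup i∈))

    -- Projection s x es vs y: the walk es, vs of H from copy s x to y is the
    -- copy on side s of a walk of G from x inside A s avoiding e.
    record Projection (s : Side) (x : Fin (n G)) (es : List (Fin (m G + m G)))
                      (vs : List (Fin (n G + n G))) (y : Fin (n G + n G)) : Set where
      constructor projection
      field
        edges     : List (Fin (m G))
        vertices  : List (Fin (n G))
        target    : Fin (n G)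
        edges≡    : es ≡ map (copy s) edges
        vertices≡ : vs ≡ map (copy s) vertices
        target≡   : y ≡ copy s target
        avoids-e  : All (_≢ e) edges
        walk      : Walk G (A s) x edges vertices target

    project : ∀ s {x es vs y} → Walk (H G e) B (copy s x) es vs y → All Ordinary es → Projection s x es vs y
    project s [] [] = projection [] [] _ refl refl refl [] []
    project s (step j j∈B w) ((t , i , i≢e , refl) ∷ ords) with joins-ordinary {t} {s} i≢e j
    ... | refl , _ , refl , j′ with project s w ords
    ...   | projection es′ vs′ y′ refl refl refl fresh w′ =
            projection (i ∷ es′) (_ ∷ vs′) y′ refl refl refl (i≢e ∷ fresh) (step j′ (copy-∈ j∈B) w′)

    cycle-in-one-copy : ∀ {x es vs} → CycleWalk (H G e) B x es vs → All Ordinary es → ∃ λ s → HasCycle G (A s)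
    cycle-in-one-copy {x} (w , ne , ue , uv) ords with copy-view {n G} x
    ... | copy-of s x′ with project s w ords
    ...   | projection es′ _ _ refl refl closes _ w′ with copy-injective s s closes
    ...     | refl , refl = s , cycleWalk⇒hasCycle (w′ , ne ∘ cong (map (copy s)) , map⁻ ue , map⁻ uv)

    -- A cycle of H inside B starting with a cross edge returns by the other
    -- cross edge; the path in between, closed up by e, is a cycle of G.
    cycle-through-cross : ∀ {t y es vs} → CycleWalk (H G e) B y (copy t e ∷ es) vs → ∃ λ s → HasCycle G (A s)
    cycle-through-cross {t} (step {z = w} j j∈B walk , _ , ue , uv) with copy-view {n G} w | first-or-all classify _
    ... | copy-of s w′ | inj₂ ords with project s walk ords
    ...   | projection _ _ _ refl refl refl _ _ = ⊥-elim (cross-switches t s j)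
    cycle-through-cross {t} (step j j∈B walk , _ , ue , uv) | copy-of s w′ | inj₁ fst with toView fst
    ... | split-at-first {xs = r₁} ords (t′ , refl) r₂ with walk-split r₁ walk
    ...   | p , _ , _ , refl , w₁ , step j′ j′∈B _ with project s w₁ ords
    ...     | projection _ vs₁′ p′ refl refl refl fresh w₁′ =
              s , close-path w₁′ e-closes e∈A fresh (map⁻ (unique-++ˡ (AllPairs.tail ue))) path-unique
      where
      t≢t′ : t ≢ t′
      t≢t′ t≡t′ = All.head (All.++⁻ʳ r₁ (AllPairs.head ue)) (cong (λ s → copy s e) t≡t′)

      e∈A : e ∈ A s
      e∈A with two-sides t≢t′ s
      ... | inj₁ refl = copy-∈ j∈B
      ... | inj₂ refl = copy-∈ j′∈B

      e-closes : Joins G e p′ w′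
      e-closes = subst₂ (Joins G e) (sym (cross-end t′ s j′)) (sym (cross-end t s (swap-joins (H G e) j))) (endOn-joins t≢t′ s)

      path-unique : Unique (vs₁′ ++ [ p′ ])
      path-unique = map⁻ (subst Unique (sym (map-++ (copy s) vs₁′ [ p′ ]))
                                 (unique-upto (map (copy s) vs₁′) (AllPairs.tail uv)))

    cycle-projects : HasCycle (H G e) B → ∃ λ s → HasCycle G (A s)
    cycle-projects hc with hasCycle⇒cycleWalk hc
    ... | _ , es , _ , cyc with first-or-all classify es
    ...   | inj₂ ords = cycle-in-one-copy cyc ords
    ...   | inj₁ fst with toView fst
    ...     | split-at-first {xs = es₁} _ (t , refl) _ with rotate-cycleWalk es₁ cyc
    ...       | _ , _ , rotated = cycle-through-cross {t} rotated

    forest-union : (∀ s → IsForest G (A s)) → IsForest (H G e) B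
    forest-union forest hc with cycle-projects hc
    ... | s , c = forest s c

lemma5p1 : (G : Graph) (e : Fin (m G)) → F G * F G ≤ F (H G e)
lemma5p1 G e = count-product (m G) (isForest? G) (isForest? G) (isForest? (H G e))
  λ A₁ A₂ forest₁ forest₂ → DoubleCover.forest-union G e (sides A₁ A₂) λ { first → forest₁ ; second → forest₂ }
  where
  sides : Subset (m G) → Subset (m G) → Side → Subset (m G)
  sides A₁ _  first  = A₁
  sides _  A₂ second = A₂
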